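{- Let $\mathbb{F}$ be a field of characteristic $2$ and $P\in\mathbb{F}[x_1,\dots,x_m]$. Then $P$ is representable if and only if $P$ admits a generalized symmetric determinantal representation.
   Context: $P$ is representable if there is a symmetric matrix $M$ with all entries in $\mathbb{F}\cup\{x_1,\dots,x_m\}$ with $\det(M)=P$. A generalized symmetric determinantal representation (gSDR) of $P$ is a symmetric matrix $M$ with entries in $\mathbb{F}[x_1,\dots,x_m]$ such that $\det(M)=P$ and each diagonal entry is either a constant of $\mathbb{F}$ or of the form $P_0^2+x_1P_1^2+\dots+x_mP_m^2$ for some $P_0,\dots,P_m\in\mathbb{F}[x_1,\dots,x_m]$. -}

module Defs where

open import Level using (Level; _⊔_; suc)
open import Algebra.Bundles using (CommutativeRing)
open import Data.Nat using (ℕ; zero) renaming (suc to sucℕ)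
open import Data.Fin using (Fin; toℕ; punchIn)
open import Data.List using (List; foldr; map; allFin)
open import Data.Product using (Σ; ∃; _×_; _,_)
open import Data.Sum using (_⊎_)
open import Relation.Nullary using (¬_)

private variable c ℓ : Level

record Field c ℓ : Set (suc (c ⊔ ℓ)) where
  field
    commutativeRing : CommutativeRing c ℓ
  open CommutativeRing commutativeRing public
  field
    1≉0     : ¬ (1# ≈ 0#)
    inverse : ∀ x → ¬ (x ≈ 0#) → ∃ λ y → x * y ≈ 1#

Char2 : Field c ℓ → Set ℓ
Char2 F = 1# + 1# ≈ 0#
  where open Field F

module PolyRing (F : Field c ℓ) (m : ℕ) where
  open Field F using (_≈_; _+_; _*_; 0#; 1#) renaming (Carrier to A)

  infixl 6 _⊕_
  infixl 7 _⊗_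
  infix 4 _≈ₚ_

  data Poly : Set c where
    con : A → Poly
    var : Fin m → Poly
    _⊕_ : Poly → Poly → Poly
    _⊗_ : Poly → Poly → Poly
    ⊝_  : Poly → Poly

  -- Equality in F[x_1..x_m]: the least congruence making Poly a commutative
  -- ring and con a ring homomorphism (i.e. the free commutative F-algebra on m
  -- generators, which is the polynomial ring F[x_1,...,x_m]).
  data _≈ₚ_ : Poly → Poly → Set (c ⊔ ℓ) where
    ≈-refl   : ∀ {p} → p ≈ₚ p
    ≈-sym    : ∀ {p q} → p ≈ₚ q → q ≈ₚ p
    ≈-trans  : ∀ {p q r} → p ≈ₚ q → q ≈ₚ r → p ≈ₚ r
    con-cong : ∀ {a b} → a ≈ b → con a ≈ₚ con b
    ⊕-cong   : ∀ {p p′ q q′} → p ≈ₚ p′ → q ≈ₚ q′ → p ⊕ q ≈ₚ p′ ⊕ q′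
    ⊗-cong   : ∀ {p p′ q q′} → p ≈ₚ p′ → q ≈ₚ q′ → p ⊗ q ≈ₚ p′ ⊗ q′
    ⊝-cong   : ∀ {p q} → p ≈ₚ q → ⊝ p ≈ₚ ⊝ q
    ⊕-assoc  : ∀ p q r → (p ⊕ q) ⊕ r ≈ₚ p ⊕ (q ⊕ r)
    ⊕-comm   : ∀ p q → p ⊕ q ≈ₚ q ⊕ p
    ⊕-idˡ    : ∀ p → con 0# ⊕ p ≈ₚ p
    ⊝-invˡ   : ∀ p → (⊝ p) ⊕ p ≈ₚ con 0#
    ⊗-assoc  : ∀ p q r → (p ⊗ q) ⊗ r ≈ₚ p ⊗ (q ⊗ r)
    ⊗-comm   : ∀ p q → p ⊗ q ≈ₚ q ⊗ p
    ⊗-idˡ    : ∀ p → con 1# ⊗ p ≈ₚ p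
    distribˡ : ∀ p q r → p ⊗ (q ⊕ r) ≈ₚ (p ⊗ q) ⊕ (p ⊗ r)
    con-+    : ∀ a b → con (a + b) ≈ₚ con a ⊕ con b
    con-*    : ∀ a b → con (a * b) ≈ₚ con a ⊗ con b

  Σ[_] : ∀ {n} → (Fin n → Poly) → Poly
  Σ[ f ] = foldr _⊕_ (con 0#) (map f (allFin _))

  Matrix : ℕ → Set c
  Matrix n = Fin n → Fin n → Poly

  minor : ∀ {n} → Fin (sucℕ n) → Matrix (sucℕ n) → Matrix n
  minor j M r s = M (Data.Fin.suc r) (punchIn j s)

  signℕ : ℕ → Poly
  signℕ zero     = con 1#
  signℕ (sucℕ k) = ⊝ signℕ k

  sign : ∀ {n} → Fin n → Poly
  sign j = signℕ (toℕ j)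

  det : ∀ {n} → Matrix n → Poly
  det {zero}   M = con 1#
  det {sucℕ n} M = Σ[ (λ j → sign j ⊗ M Data.Fin.zero j ⊗ det (minor j M)) ]

  Symmetric : ∀ {n} → Matrix n → Set (c ⊔ ℓ)
  Symmetric M = ∀ i j → M i j ≈ₚ M j i

  data Entry : Set c where
    cst : A → Entry
    x   : Fin m → Entry

  ⟦_⟧ₑ : Entry → Poly
  ⟦ cst a ⟧ₑ = con a
  ⟦ x i ⟧ₑ   = var i

  Representable : Poly → Set (c ⊔ ℓ)
  Representable P =
    Σ ℕ λ n → Σ (Fin n → Fin n → Entry) λ E →
      Symmetric (λ i j → ⟦ E i j ⟧ₑ) × det (λ i j → ⟦ E i j ⟧ₑ) ≈ₚ P

  WeightedSumOfSquares : Poly → Set (c ⊔ ℓ)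
  WeightedSumOfSquares Q =
    Σ Poly λ P₀ → Σ (Fin m → Poly) λ Ps →
      Q ≈ₚ P₀ ⊗ P₀ ⊕ Σ[ (λ i → var i ⊗ (Ps i ⊗ Ps i)) ]

  IsConstant : Poly → Set (c ⊔ ℓ)
  IsConstant Q = Σ A λ a → Q ≈ₚ con a

  IsGSDR : ∀ {n} → Matrix n → Poly → Set (c ⊔ ℓ)
  IsGSDR M P = Symmetric M × det M ≈ₚ P ×
               (∀ i → IsConstant (M i i) ⊎ WeightedSumOfSquares (M i i))

  HasGSDR : Poly → Set (c ⊔ ℓ)
  HasGSDR P = Σ ℕ λ n → Σ (Matrix n) λ M → IsGSDR M P

-- In characteristic 2 determinants need no signs, and clearing the first two columns of the
-- bordered matrix [ 0 1 uᵀ ; 1 d vᵀ ; u v M ] by row operations shows that its determinant is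
-- det (M + u vᵀ + v uᵀ + d u uᵀ). Given a gSDR M, write M as a diagonal matrix of constants plus
-- pending symmetric corrections: w (Eᵢⱼ + Eⱼᵢ) for each off-diagonal entry w, and e p² Eᵢᵢ for each
-- summand of a diagonal entry P₀² + Σ xₖ Pₖ². A correction whose weight is a constant or a variable
-- is absorbed into a border with entries in F ∪ {x₁, …, xₘ}; a sum is split, a negation dropped
-- (−p = p), and a product p q or a diagonal term e p² becomes a border whose two new rows carry p and
-- q (resp. p and 0) as new corrections. The total size of the pending weights decreases, so the
-- process ends in a representation. Conversely xₖ = 0² + Σₜ xₜ δₖₜ², so a representation is a gSDR.

module Submission where

open import Defs
open import Level using (_⊔_)
open import Algebra.Bundles using (CommutativeSemiring)
open import Algebra.Structures.Biased using (IsCommutativeSemiringʳ)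
open import Data.Fin using (Fin; zero; suc; punchIn; toℕ)
open import Data.Fin.Properties using (suc-injective)
open import Data.List using (List; []; _∷_; _++_; foldr; map; tabulate)
open import Data.Nat using (ℕ; zero; suc; _+_; _<_; s≤s)
open import Data.Nat.Induction using (<-wellFounded)
open import Data.Nat.Properties as ℕₚ using (≤-reflexive)
open import Data.Product using (_,_)
open import Data.Sum using (_⊎_; inj₁; inj₂)
open import Data.Vec.Functional using (updateAt)
open import Data.Vec.Functional.Properties using (updateAt-updates; updateAt-minimal)
open import Function using (_∘_; id)
open import Function.Bundles using (_⇔_; mk⇔)
open import Induction.WellFounded using (Acc; acc)
open import Relation.Binary.PropositionalEquality as ≡ using (_≡_; _≢_)
open import Relation.Binary.Structures using (IsEquivalence)
open import Relation.Nullary using (contradiction)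

borderRow : ∀ {a} {A : Set a} {n} → A → A → (Fin n → A) → Fin (suc (suc n)) → A
borderRow x y w zero          = x
borderRow x y w (suc zero)    = y
borderRow x y w (suc (suc k)) = w k

-- bordered z o M d u v is the block matrix  [ z o uᵀ ; o d vᵀ ; u v M ].
bordered : ∀ {a} {A : Set a} {n} → A → A → (Fin n → Fin n → A) → A → (Fin n → A) → (Fin n → A) →
           Fin (suc (suc n)) → Fin (suc (suc n)) → A
bordered z o M d u v zero          = borderRow z o u
bordered z o M d u v (suc zero)    = borderRow o d v
bordered z o M d u v (suc (suc r)) = borderRow (u r) (v r) (M r)

borderRow-map : ∀ {a b} {A : Set a} {B : Set b} (f : A → B) {n} x y (w : Fin n → A) s →
  f (borderRow x y w s) ≡ borderRow (f x) (f y) (f ∘ w) s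
borderRow-map f x y w zero          = ≡.refl
borderRow-map f x y w (suc zero)    = ≡.refl
borderRow-map f x y w (suc (suc k)) = ≡.refl

bordered-map : ∀ {a b} {A : Set a} {B : Set b} (f : A → B) {n} z o (M : Fin n → Fin n → A) d u v r s →
  f (bordered z o M d u v r s) ≡ bordered (f z) (f o) (λ r s → f (M r s)) (f d) (f ∘ u) (f ∘ v) r s
bordered-map f z o M d u v zero          = borderRow-map f z o u
bordered-map f z o M d u v (suc zero)    = borderRow-map f o d v
bordered-map f z o M d u v (suc (suc r)) = borderRow-map f (u r) (v r) (M r)

bordered-sym : ∀ {a} {A : Set a} {n} z o {M : Fin n → Fin n → A} d u v → (∀ r s → M r s ≡ M s r) →
               ∀ r s → bordered z o M d u v r s ≡ bordered z o M d u v s r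
bordered-sym z o d u v M-sym zero          zero          = ≡.refl
bordered-sym z o d u v M-sym zero          (suc zero)    = ≡.refl
bordered-sym z o d u v M-sym zero          (suc (suc s)) = ≡.refl
bordered-sym z o d u v M-sym (suc zero)    zero          = ≡.refl
bordered-sym z o d u v M-sym (suc zero)    (suc zero)    = ≡.refl
bordered-sym z o d u v M-sym (suc zero)    (suc (suc s)) = ≡.refl
bordered-sym z o d u v M-sym (suc (suc r)) zero          = ≡.refl
bordered-sym z o d u v M-sym (suc (suc r)) (suc zero)    = ≡.refl
bordered-sym z o d u v M-sym (suc (suc r)) (suc (suc s)) = M-sym r s

-- For i ≢ j, punchIn₂ i j enumerates the indices other than i and j in increasing order
-- (its values for i ≡ j are irrelevant).
punchIn₂ : ∀ {n} → Fin (suc (suc n)) → Fin (suc (suc n)) → Fin n → Fin (suc (suc n))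
punchIn₂ zero    zero    s = suc (suc s)
punchIn₂ zero    (suc j) s = suc (punchIn j s)
punchIn₂ (suc i) zero    s = suc (punchIn i s)
punchIn₂ {suc n} (suc i) (suc j) zero    = zero
punchIn₂ {suc n} (suc i) (suc j) (suc s) = suc (punchIn₂ i j s)

punchIn₂-comm : ∀ {n} (i j : Fin (suc (suc n))) s → punchIn₂ i j s ≡ punchIn₂ j i s
punchIn₂-comm zero    zero    s = ≡.refl
punchIn₂-comm zero    (suc j) s = ≡.refl
punchIn₂-comm (suc i) zero    s = ≡.refl
punchIn₂-comm {suc n} (suc i) (suc j) zero    = ≡.refl
punchIn₂-comm {suc n} (suc i) (suc j) (suc s) = ≡.cong suc (punchIn₂-comm i j s)

punchIn-punchIn : ∀ {n} (i : Fin (suc (suc n))) j s → punchIn i (punchIn j s) ≡ punchIn₂ i (punchIn i j) s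
punchIn-punchIn zero    j       s = ≡.refl
punchIn-punchIn (suc i) zero    s = ≡.refl
punchIn-punchIn {suc n} (suc i) (suc j) zero    = ≡.refl
punchIn-punchIn {suc n} (suc i) (suc j) (suc s) = ≡.cong suc (punchIn-punchIn i j s)

swap01 : ∀ {n} → Fin (suc (suc n)) → Fin (suc (suc n))
swap01 zero          = suc zero
swap01 (suc zero)    = zero
swap01 (suc (suc r)) = suc (suc r)

module Polynomials {c ℓ} (F : Field c ℓ) (m : ℕ) where
  open PolyRing F m public
  open Field F using () renaming (0# to 0F; 1# to 1F)

  0ₚ 1ₚ : Poly
  0ₚ = con 0F
  1ₚ = con 1F

  ⊗-zeroʳ : ∀ p → p ⊗ 0ₚ ≈ₚ 0ₚ
  ⊗-zeroʳ p = cancel (≈-trans (≈-sym (distribˡ p 0ₚ 0ₚ)) (⊗-cong ≈-refl (⊕-idˡ 0ₚ)))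
    where
    cancel : ∀ {y} → y ⊕ y ≈ₚ y → y ≈ₚ 0ₚ
    cancel {y} y+y≈y = ≈-trans (≈-sym (⊕-idˡ y)) (≈-trans (⊕-cong (≈-sym (⊝-invˡ y)) ≈-refl)
      (≈-trans (⊕-assoc _ _ _) (≈-trans (⊕-cong ≈-refl y+y≈y) (⊝-invˡ y))))

  polySemiring : CommutativeSemiring c (c ⊔ ℓ)
  polySemiring = record
    { Carrier = Poly ; _≈_ = _≈ₚ_ ; _+_ = _⊕_ ; _*_ = _⊗_ ; 0# = 0ₚ ; 1# = 1ₚ
    ; isCommutativeSemiring = IsCommutativeSemiringʳ.isCommutativeSemiring record
      { +-isCommutativeMonoid = record
        { isMonoid = record
          { isSemigroup = record { isMagma = record { isEquivalence = isEquivalence ; ∙-cong = ⊕-cong }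
                                 ; assoc = ⊕-assoc }
          ; identity = ⊕-idˡ , λ p → ≈-trans (⊕-comm p 0ₚ) (⊕-idˡ p) }
        ; comm = ⊕-comm }
      ; *-isCommutativeMonoid = record
        { isMonoid = record
          { isSemigroup = record { isMagma = record { isEquivalence = isEquivalence ; ∙-cong = ⊗-cong }
                                 ; assoc = ⊗-assoc }
          ; identity = ⊗-idˡ , λ p → ≈-trans (⊗-comm p 1ₚ) (⊗-idˡ p) }
        ; comm = ⊗-comm }
      ; distribˡ = distribˡ
      ; zeroʳ = ⊗-zeroʳ } }
    where
    isEquivalence : IsEquivalence _≈ₚ_
    isEquivalence = record { refl = ≈-refl ; sym = ≈-sym ; trans = ≈-trans }

  open CommutativeSemiring polySemiring public
    using (setoid; refl; sym; trans; reflexive; +-congˡ; +-congʳ; *-congˡ; *-congʳ;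
           +-cong; *-cong; *-comm; distribʳ; +-identityˡ; +-identityʳ; *-identityˡ; *-identityʳ; zeroˡ; zeroʳ; +-assoc)
  open import Relation.Binary.Reasoning.Setoid setoid public
  open import Algebra.Solver.Ring.NaturalCoefficients.Default polySemiring public
    using (solve; _:=_; _:+_; _:*_) renaming (con to κ)
  open import Algebra.Properties.Semiring.Sum (CommutativeSemiring.semiring polySemiring) public
    using (sum; sum-syntax; sum-cong-≋; ∑-distrib-+; *-distribˡ-sum; sum-replicate-zero)

  Σ[]≡sum : ∀ {n} (f : Fin n → Poly) → Σ[ f ] ≡ sum f
  Σ[]≡sum f = foldr-tabulate id
    where
    foldr-tabulate : ∀ {k} (g : Fin k → Fin _) → foldr _⊕_ 0ₚ (map f (tabulate g)) ≡ sum (f ∘ g)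
    foldr-tabulate {zero} g = ≡.refl
    foldr-tabulate {suc k} g = ≡.cong (f (g zero) ⊕_) (foldr-tabulate (g ∘ suc))

  ∑-linear : ∀ {n} (f : Fin n → Poly) a g → ∑[ i < n ] (f i ⊕ a ⊗ g i) ≈ₚ sum f ⊕ a ⊗ sum g
  ∑-linear f a g = trans (∑-distrib-+ f (λ i → a ⊗ g i)) (+-congˡ (sym (*-distribˡ-sum a g)))

  sum-≈0 : ∀ {n} {f : Fin n → Poly} → (∀ i → f i ≈ₚ 0ₚ) → sum f ≈ₚ 0ₚ
  sum-≈0 {n} f≈0 = trans (sum-cong-≋ f≈0) (sum-replicate-zero n)

  ε : ∀ {n} → Fin n → Fin n → Poly
  ε zero    zero    = 1ₚ
  ε zero    (suc _) = 0ₚ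
  ε (suc _) zero    = 0ₚ
  ε (suc i) (suc j) = ε i j

  ε-sym : ∀ {n} (i j : Fin n) → ε i j ≡ ε j i
  ε-sym zero    zero    = ≡.refl
  ε-sym zero    (suc _) = ≡.refl
  ε-sym (suc _) zero    = ≡.refl
  ε-sym (suc i) (suc j) = ε-sym i j

  ε-diag : ∀ {n} (i : Fin n) → ε i i ≡ 1ₚ
  ε-diag zero    = ≡.refl
  ε-diag (suc i) = ε-diag i

  ε-≢ : ∀ {n} {i j : Fin n} → i ≢ j → ε i j ≡ 0ₚ
  ε-≢ {i = zero}  {zero}  i≢j = contradiction ≡.refl i≢j
  ε-≢ {i = zero}  {suc j} _   = ≡.refl
  ε-≢ {i = suc i} {zero}  _   = ≡.refl
  ε-≢ {i = suc i} {suc j} i≢j = ε-≢ (i≢j ∘ ≡.cong suc)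

  ε-idem : ∀ {n} (i j : Fin n) → ε i j ⊗ ε i j ≈ₚ ε i j
  ε-idem zero    zero    = *-identityˡ 1ₚ
  ε-idem zero    (suc _) = zeroˡ 0ₚ
  ε-idem (suc _) zero    = zeroˡ 0ₚ
  ε-idem (suc i) (suc j) = ε-idem i j

  ∑-ε : ∀ {n} (f : Fin n → Poly) j → ∑[ i < n ] (ε i j ⊗ f i) ≈ₚ f j
  ∑-ε f zero    = trans (+-cong (*-identityˡ _) (sum-≈0 (λ i → zeroˡ (f (suc i))))) (+-identityʳ _)
  ∑-ε f (suc j) = trans (+-cong (zeroˡ _) (∑-ε (f ∘ suc) j)) (+-identityˡ _)

  ∑≢ : ∀ {n} → (Fin (suc n) → Fin (suc n) → Poly) → Poly
  ∑≢ {n} G = ∑[ i < suc n ] ∑[ k < n ] G i (punchIn i k)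

  ∑≢-cong : ∀ {n} {G H : Fin (suc n) → Fin (suc n) → Poly} → (∀ i j → G i j ≈ₚ H i j) → ∑≢ G ≈ₚ ∑≢ H
  ∑≢-cong G≈H = sum-cong-≋ λ i → sum-cong-≋ λ k → G≈H i (punchIn i k)

  ∑≢-split : ∀ {n} (G : Fin (suc (suc n)) → Fin (suc (suc n)) → Poly) →
    ∑≢ G ≈ₚ ∑[ k < suc n ] G zero (suc k) ⊕ (∑[ k < suc n ] G (suc k) zero ⊕ ∑≢ (λ i j → G (suc i) (suc j)))
  ∑≢-split G = +-congˡ (∑-distrib-+ (λ i → G (suc i) zero) (λ i → sum (λ k → G (suc i) (suc (punchIn i k)))))

  ∑≢-transpose : ∀ {n} (G : Fin (suc n) → Fin (suc n) → Poly) → ∑≢ G ≈ₚ ∑≢ (λ i j → G j i)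
  ∑≢-transpose {zero}  G = refl
  ∑≢-transpose {suc n} G = begin
    ∑≢ G                         ≈⟨ ∑≢-split G ⟩
    A ⊕ (B ⊕ ∑≢ G↓)              ≈⟨ +-congˡ (+-congˡ (∑≢-transpose G↓)) ⟩
    A ⊕ (B ⊕ ∑≢ (λ i j → G↓ j i)) ≈⟨ solve 3 (λ a b c → a :+ (b :+ c) := b :+ (a :+ c)) refl A B _ ⟩
    B ⊕ (A ⊕ ∑≢ (λ i j → G↓ j i)) ≈⟨ ∑≢-split (λ i j → G j i) ⟨
    ∑≢ (λ i j → G j i)           ∎
    where
    A = ∑[ k < suc n ] G zero (suc k)
    B = ∑[ k < suc n ] G (suc k) zero
    G↓ = λ i j → G (suc i) (suc j)

  minor₂ : ∀ {n} → Fin (suc (suc n)) → Fin (suc (suc n)) → Matrix (suc (suc n)) → Matrix n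
  minor₂ i j M r s = M (suc (suc r)) (punchIn₂ i j s)

  lowerRight : ∀ {n} → Matrix (suc (suc n)) → Matrix n
  lowerRight M r s = M (suc (suc r)) (suc (suc s))

  addScaledRow : ∀ {n} → Fin n → Poly → Fin n → Matrix n → Matrix n
  addScaledRow k a j M r s = M r s ⊕ ε k r ⊗ (a ⊗ M j s)

  addScaledRow-other : ∀ {n} {k r : Fin n} a j M → r ≢ k → ∀ s → addScaledRow k a j M r s ≈ₚ M r s
  addScaledRow-other {k = k} {r} a j M r≢k s = begin
    M r s ⊕ ε k r ⊗ (a ⊗ M j s)  ≡⟨ ≡.cong (λ e → M r s ⊕ e ⊗ (a ⊗ M j s)) (ε-≢ (r≢k ∘ ≡.sym)) ⟩
    M r s ⊕ 0ₚ ⊗ (a ⊗ M j s)     ≈⟨ +-congˡ (zeroˡ _) ⟩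
    M r s ⊕ 0ₚ                   ≈⟨ +-identityʳ _ ⟩
    M r s                        ∎

  clearBorderColumns : ∀ {n} → Fin n → Fin n → Poly → Poly → Poly → Matrix (suc (suc n)) → Matrix (suc (suc n))
  clearBorderColumns i j d p q N =
    addScaledRow (suc (suc j)) q zero (addScaledRow (suc (suc i)) p (suc zero) (addScaledRow (suc (suc i)) (p ⊗ d) zero N))

  clearBorderColumns-top : ∀ {n} (i j : Fin n) d p q N {t} → (∀ a → t ≢ suc (suc a)) →
                           ∀ s → clearBorderColumns i j d p q N t s ≈ₚ N t s
  clearBorderColumns-top i j d p q N {t} t≢ s =
    trans (addScaledRow-other {k = suc (suc j)} {t} q zero N₂ (t≢ j) s)
          (trans (addScaledRow-other {k = suc (suc i)} {t} p (suc zero) N₁ (t≢ i) s)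
                 (addScaledRow-other {k = suc (suc i)} {t} (p ⊗ d) zero N (t≢ i) s))
    where
    N₁ = addScaledRow (suc (suc i)) (p ⊗ d) zero N
    N₂ = addScaledRow (suc (suc i)) p (suc zero) N₁

  clearBorderColumns-lower : ∀ {n} (i j : Fin n) d p q N r s → clearBorderColumns i j d p q N (suc (suc r)) s ≈ₚ
    N (suc (suc r)) s ⊕ (ε i r ⊗ (p ⊗ d ⊗ N zero s ⊕ p ⊗ N (suc zero) s) ⊕ ε j r ⊗ (q ⊗ N zero s))
  clearBorderColumns-lower i j d p q N r s = begin
    (N (suc (suc r)) s ⊕ ε i r ⊗ (p ⊗ d ⊗ N zero s)) ⊕ ε i r ⊗ (p ⊗ N₁ (suc zero) s) ⊕ ε j r ⊗ (q ⊗ N₂ zero s)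
      ≈⟨ +-cong (+-congˡ (*-congˡ (*-congˡ (addScaledRow-other {k = suc (suc i)} {suc zero} (p ⊗ d) zero N (λ ()) s))))
                (*-congˡ (*-congˡ (trans (addScaledRow-other {k = suc (suc i)} {zero} p (suc zero) N₁ (λ ()) s)
                                         (addScaledRow-other {k = suc (suc i)} {zero} (p ⊗ d) zero N (λ ()) s)))) ⟩
    (N (suc (suc r)) s ⊕ ε i r ⊗ (p ⊗ d ⊗ N zero s)) ⊕ ε i r ⊗ (p ⊗ N (suc zero) s) ⊕ ε j r ⊗ (q ⊗ N zero s)
      ≈⟨ solve 8 (λ x e f p d q a b → (x :+ e :* (p :* d :* a)) :+ e :* (p :* b) :+ f :* (q :* a)
                                    := x :+ (e :* (p :* d :* a :+ p :* b) :+ f :* (q :* a)))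
               refl (N (suc (suc r)) s) (ε i r) (ε j r) p d q (N zero s) (N (suc zero) s) ⟩
    N (suc (suc r)) s ⊕ (ε i r ⊗ (p ⊗ d ⊗ N zero s ⊕ p ⊗ N (suc zero) s) ⊕ ε j r ⊗ (q ⊗ N zero s)) ∎
    where
    N₁ = addScaledRow (suc (suc i)) (p ⊗ d) zero N
    N₂ = addScaledRow (suc (suc i)) p (suc zero) N₁

  border : ∀ {n} → Matrix n → Poly → (Fin n → Poly) → (Fin n → Poly) → Matrix (suc (suc n))
  border = bordered 0ₚ 1ₚ

  border-cong : ∀ {n} (M : Matrix n) d {u u′ v v′ : Fin n → Poly} →
                (∀ k → u k ≈ₚ u′ k) → (∀ k → v k ≈ₚ v′ k) →
                ∀ r s → border M d u v r s ≈ₚ border M d u′ v′ r s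
  border-cong M d u≈ v≈ zero          zero          = refl
  border-cong M d u≈ v≈ zero          (suc zero)    = refl
  border-cong M d u≈ v≈ zero          (suc (suc s)) = u≈ s
  border-cong M d u≈ v≈ (suc zero)    zero          = refl
  border-cong M d u≈ v≈ (suc zero)    (suc zero)    = refl
  border-cong M d u≈ v≈ (suc zero)    (suc (suc s)) = v≈ s
  border-cong M d u≈ v≈ (suc (suc r)) zero          = u≈ r
  border-cong M d u≈ v≈ (suc (suc r)) (suc zero)    = v≈ r
  border-cong M d u≈ v≈ (suc (suc r)) (suc (suc s)) = refl

  edgeMatrix : ∀ {n} → Fin n → Fin n → Poly → Matrix n
  edgeMatrix i j w r s = (ε i r ⊗ ε j s ⊕ ε j r ⊗ ε i s) ⊗ w

  diagMatrix : ∀ {n} → Fin n → Poly → Matrix n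
  diagMatrix i w r s = (ε i r ⊗ ε i s) ⊗ w

  border-absorbEdges : ∀ {n} (X : Matrix n) d u v (i j : Fin n) p q r s →
    border X d u v r s ⊕ (edgeMatrix zero (suc (suc i)) p r s ⊕ edgeMatrix (suc zero) (suc (suc j)) q r s) ≈ₚ
    border X d (λ k → u k ⊕ ε i k ⊗ p) (λ k → v k ⊕ ε j k ⊗ q) r s
  border-absorbEdges X d u v i j p q zero zero =
    solve 2 (λ p q → κ 0 :+ ((κ 1 :* κ 0 :+ κ 0 :* κ 1) :* p :+ (κ 0 :* κ 0 :+ κ 0 :* κ 0) :* q) := κ 0) refl p q
  border-absorbEdges X d u v i j p q zero (suc zero) =
    solve 2 (λ p q → κ 1 :+ ((κ 1 :* κ 0 :+ κ 0 :* κ 0) :* p :+ (κ 0 :* κ 0 :+ κ 0 :* κ 1) :* q) := κ 1) refl p q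
  border-absorbEdges X d u v i j p q zero (suc (suc k)) =
    solve 5 (λ x e f p q → x :+ ((κ 1 :* e :+ κ 0 :* κ 0) :* p :+ (κ 0 :* f :+ κ 0 :* κ 0) :* q) := x :+ e :* p)
          refl (u k) (ε i k) (ε j k) p q
  border-absorbEdges X d u v i j p q (suc zero) zero =
    solve 2 (λ p q → κ 1 :+ ((κ 0 :* κ 0 :+ κ 0 :* κ 1) :* p :+ (κ 1 :* κ 0 :+ κ 0 :* κ 0) :* q) := κ 1) refl p q
  border-absorbEdges X d u v i j p q (suc zero) (suc zero) =
    solve 3 (λ d p q → d :+ ((κ 0 :* κ 0 :+ κ 0 :* κ 0) :* p :+ (κ 1 :* κ 0 :+ κ 0 :* κ 1) :* q) := d) refl d p q
  border-absorbEdges X d u v i j p q (suc zero) (suc (suc k)) =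
    solve 5 (λ y e f p q → y :+ ((κ 0 :* e :+ κ 0 :* κ 0) :* p :+ (κ 1 :* f :+ κ 0 :* κ 0) :* q) := y :+ f :* q)
          refl (v k) (ε i k) (ε j k) p q
  border-absorbEdges X d u v i j p q (suc (suc r)) zero =
    solve 5 (λ x e f p q → x :+ ((κ 0 :* κ 0 :+ e :* κ 1) :* p :+ (κ 0 :* κ 0 :+ f :* κ 0) :* q) := x :+ e :* p)
          refl (u r) (ε i r) (ε j r) p q
  border-absorbEdges X d u v i j p q (suc (suc r)) (suc zero) =
    solve 5 (λ y e f p q → y :+ ((κ 0 :* κ 0 :+ e :* κ 0) :* p :+ (κ 0 :* κ 0 :+ f :* κ 1) :* q) := y :+ f :* q)
          refl (v r) (ε i r) (ε j r) p q
  border-absorbEdges X d u v i j p q (suc (suc r)) (suc (suc s)) =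
    solve 7 (λ x e e′ f f′ p q → x :+ ((κ 0 :* e′ :+ e :* κ 0) :* p :+ (κ 0 :* f′ :+ f :* κ 0) :* q) := x)
          refl (X r s) (ε i r) (ε i s) (ε j r) (ε j s) p q

  -- Entry matrices and pending corrections

  EntryMatrix : ℕ → Set c
  EntryMatrix n = Fin n → Fin n → Entry

  ⟦_⟧ₘ : ∀ {n} → EntryMatrix n → Matrix n
  ⟦ B ⟧ₘ r s = ⟦ B r s ⟧ₑ

  SymmetricEntries : ∀ {n} → EntryMatrix n → Set c
  SymmetricEntries B = ∀ r s → B r s ≡ B s r

  borderE : ∀ {n} → EntryMatrix n → Entry → (Fin n → Entry) → (Fin n → Entry) → EntryMatrix (suc (suc n))
  borderE = bordered (cst 0F) (cst 1F)

  εₑ : ∀ {n} → Fin n → Fin n → Entry → Entry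
  εₑ zero    zero    e = e
  εₑ zero    (suc _) e = cst 0F
  εₑ (suc _) zero    e = cst 0F
  εₑ (suc i) (suc j) e = εₑ i j e

  ⟦εₑ⟧ : ∀ {n} (i j : Fin n) e → ⟦ εₑ i j e ⟧ₑ ≈ₚ ε i j ⊗ ⟦ e ⟧ₑ
  ⟦εₑ⟧ zero    zero    e = sym (*-identityˡ _)
  ⟦εₑ⟧ zero    (suc _) e = sym (zeroˡ _)
  ⟦εₑ⟧ (suc _) zero    e = sym (zeroˡ _)
  ⟦εₑ⟧ (suc i) (suc j) e = ⟦εₑ⟧ i j e

  εₑ-diagonal-sym : ∀ {n} (f : Fin n → Entry) r s → εₑ r s (f r) ≡ εₑ s r (f s)
  εₑ-diagonal-sym f zero    zero    = ≡.refl
  εₑ-diagonal-sym f zero    (suc s) = ≡.refl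
  εₑ-diagonal-sym f (suc r) zero    = ≡.refl
  εₑ-diagonal-sym f (suc r) (suc s) = εₑ-diagonal-sym (f ∘ suc) r s

  data Item (n : ℕ) : Set c where
    edge : Fin n → Fin n → Poly → Item n
    diag : Fin n → Entry → Poly → Item n

  ⟦_⟧ᵢ : ∀ {n} → Item n → Matrix n
  ⟦ edge i j w ⟧ᵢ = edgeMatrix i j w
  ⟦ diag i e p ⟧ᵢ = diagMatrix i (⟦ e ⟧ₑ ⊗ (p ⊗ p))

  itemSum : ∀ {n} → List (Item n) → Matrix n
  itemSum []       r s = 0ₚ
  itemSum (t ∷ ts) r s = ⟦ t ⟧ᵢ r s ⊕ itemSum ts r s

  realise : ∀ {n} → EntryMatrix n → List (Item n) → Matrix n
  realise B ts r s = ⟦ B r s ⟧ₑ ⊕ itemSum ts r s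

  ↑ : ∀ {n} → Item n → Item (suc n)
  ↑ (edge i j w) = edge (suc i) (suc j) w
  ↑ (diag i e p) = diag (suc i) e p

  shift₂ : ∀ {n} → List (Item n) → List (Item (suc (suc n)))
  shift₂ ts = map ↑ (map ↑ ts)

  itemSum-↑ : ∀ {n} (ts : List (Item n)) r s → itemSum (map ↑ ts) (suc r) (suc s) ≡ itemSum ts r s
  itemSum-↑ []       r s = ≡.refl
  itemSum-↑ (t ∷ ts) r s = ≡.cong₂ _⊕_ (entry t) (itemSum-↑ ts r s)
    where
    entry : ∀ t → ⟦ ↑ t ⟧ᵢ (suc r) (suc s) ≡ ⟦ t ⟧ᵢ r s
    entry (edge _ _ _) = ≡.refl
    entry (diag _ _ _) = ≡.refl

  itemSum-↑-row₀ : ∀ {n} (ts : List (Item n)) s → itemSum (map ↑ ts) zero s ≈ₚ 0ₚ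
  itemSum-↑-row₀ []       s = refl
  itemSum-↑-row₀ (t ∷ ts) s = trans (+-cong (entry t) (itemSum-↑-row₀ ts s)) (+-identityˡ 0ₚ)
    where
    entry : ∀ t → ⟦ ↑ t ⟧ᵢ zero s ≈ₚ 0ₚ
    entry (edge _ _ w) = solve 3 (λ a b w → (κ 0 :* a :+ κ 0 :* b) :* w := κ 0) refl _ _ w
    entry (diag _ _ _) = solve 2 (λ a w → (κ 0 :* a) :* w := κ 0) refl _ _

  itemSum-↑-column₀ : ∀ {n} (ts : List (Item n)) r → itemSum (map ↑ ts) r zero ≈ₚ 0ₚ
  itemSum-↑-column₀ []       r = refl
  itemSum-↑-column₀ (t ∷ ts) r = trans (+-cong (entry t) (itemSum-↑-column₀ ts r)) (+-identityˡ 0ₚ)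
    where
    entry : ∀ t → ⟦ ↑ t ⟧ᵢ r zero ≈ₚ 0ₚ
    entry (edge _ _ w) = solve 3 (λ a b w → (a :* κ 0 :+ b :* κ 0) :* w := κ 0) refl _ _ w
    entry (diag _ _ _) = solve 2 (λ a w → (a :* κ 0) :* w := κ 0) refl _ _

  realise-borderE : ∀ {n} (B : EntryMatrix n) d u v ts r s →
    realise (borderE B d u v) (shift₂ ts) r s ≈ₚ border (realise B ts) ⟦ d ⟧ₑ (⟦_⟧ₑ ∘ u) (⟦_⟧ₑ ∘ v) r s
  realise-borderE B d u v ts r s =
    trans (+-congʳ (reflexive (bordered-map ⟦_⟧ₑ (cst 0F) (cst 1F) B d u v r s))) (shifted r s)
    where
    σ = itemSum (shift₂ ts)
    vanish : ∀ {x r s} → σ r s ≈ₚ 0ₚ → x ⊕ σ r s ≈ₚ x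
    vanish σ≈0 = trans (+-congˡ σ≈0) (+-identityʳ _)
    shifted : ∀ r s → border ⟦ B ⟧ₘ ⟦ d ⟧ₑ (⟦_⟧ₑ ∘ u) (⟦_⟧ₑ ∘ v) r s ⊕ σ r s ≈ₚ
                      border (realise B ts) ⟦ d ⟧ₑ (⟦_⟧ₑ ∘ u) (⟦_⟧ₑ ∘ v) r s
    shifted zero          s             = vanish (itemSum-↑-row₀ (map ↑ ts) s)
    shifted (suc zero)    zero          = vanish (itemSum-↑-column₀ (map ↑ ts) (suc zero))
    shifted (suc zero)    (suc s)       =
      vanish (trans (reflexive (itemSum-↑ (map ↑ ts) zero s)) (itemSum-↑-row₀ ts s))
    shifted (suc (suc r)) zero          = vanish (itemSum-↑-column₀ (map ↑ ts) (suc (suc r)))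
    shifted (suc (suc r)) (suc zero)    =
      vanish (trans (reflexive (itemSum-↑ (map ↑ ts) (suc r) zero)) (itemSum-↑-column₀ ts (suc r)))
    shifted (suc (suc r)) (suc (suc s)) =
      +-congˡ (reflexive (≡.trans (itemSum-↑ (map ↑ ts) (suc r) (suc s)) (itemSum-↑ ts r s)))

  realise-sum : ∀ {n} (B : EntryMatrix n) i j p q ts r s →
    realise B (edge i j (p ⊕ q) ∷ ts) r s ≈ₚ realise B (edge i j p ∷ edge i j q ∷ ts) r s
  realise-sum B i j p q ts r s = solve 5 (λ b σ E p q → b :+ (E :* (p :+ q) :+ σ) := b :+ (E :* p :+ (E :* q :+ σ)))
                                       refl ⟦ B r s ⟧ₑ (itemSum ts r s) (ε i r ⊗ ε j s ⊕ ε j r ⊗ ε i s) p q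

  size : Poly → ℕ
  size (con _) = 1
  size (var _) = 1
  size (p ⊕ q) = suc (size p + size q)
  size (p ⊗ q) = suc (size p + size q)
  size (⊝ p)   = suc (size p)

  weight : ∀ {n} → Item n → ℕ
  weight (edge _ _ w) = size w
  weight (diag _ _ p) = suc (size p + size 0ₚ)  -- one more than the edges p and 0ₚ it is traded for

  totalWeight : ∀ {n} → List (Item n) → ℕ
  totalWeight []       = 0
  totalWeight (t ∷ ts) = weight t + totalWeight ts

  totalWeight-↑ : ∀ {n} (ts : List (Item n)) → totalWeight (map ↑ ts) ≡ totalWeight ts
  totalWeight-↑ []                = ≡.refl
  totalWeight-↑ (edge _ _ w ∷ ts) = ≡.cong (size w +_) (totalWeight-↑ ts)
  totalWeight-↑ (diag _ _ p ∷ ts) = ≡.cong (suc (size p + size 0ₚ) +_) (totalWeight-↑ ts)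

  totalWeight-shift₂ : ∀ {n} (ts : List (Item n)) → totalWeight (shift₂ ts) ≡ totalWeight ts
  totalWeight-shift₂ ts = ≡.trans (totalWeight-↑ (map ↑ ts)) (totalWeight-↑ ts)

  +-regroup< : ∀ a b {x y} → x ≡ y → a + (b + x) < suc (a + b) + y
  +-regroup< a b ≡.refl = s≤s (≤-reflexive (≡.sym (ℕₚ.+-assoc a b _)))

  -- The initial decomposition of a gSDR

  DiagonalForm : Poly → Set (c ⊔ ℓ)
  DiagonalForm q = IsConstant q ⊎ WeightedSumOfSquares q

  constantPart : ∀ {q} → DiagonalForm q → Entry
  constantPart (inj₁ (a , _)) = cst a
  constantPart (inj₂ _)       = cst 0F

  squaresPart : ∀ {q} → DiagonalForm q → Poly
  squaresPart (inj₁ _)             = 0ₚ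
  squaresPart (inj₂ (p₀ , ps , _)) = p₀ ⊗ p₀ ⊕ ∑[ k < m ] (var k ⊗ (ps k ⊗ ps k))

  squareItems : ∀ {n q} → DiagonalForm q → List (Item (suc n))
  squareItems (inj₁ _)             = []
  squareItems (inj₂ (p₀ , ps , _)) = diag zero (cst 1F) p₀ ∷ tabulate (λ k → diag zero (x k) (ps k))

  itemSum-++ : ∀ {n} (ts us : List (Item n)) r s → itemSum (ts ++ us) r s ≈ₚ itemSum ts r s ⊕ itemSum us r s
  itemSum-++ []       us r s = sym (+-identityˡ _)
  itemSum-++ (t ∷ ts) us r s = trans (+-congˡ (itemSum-++ ts us r s)) (sym (+-assoc _ _ _))

  itemSum-tabulate : ∀ {n k} (f : Fin k → Item n) r s → itemSum (tabulate f) r s ≡ ∑[ t < k ] ⟦ f t ⟧ᵢ r s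
  itemSum-tabulate {k = zero}  f r s = ≡.refl
  itemSum-tabulate {k = suc k} f r s = ≡.cong (⟦ f zero ⟧ᵢ r s ⊕_) (itemSum-tabulate (f ∘ suc) r s)

  itemSum-squareItems : ∀ {n q} (f : DiagonalForm q) (r s : Fin (suc n)) →
                        itemSum (squareItems f) r s ≈ₚ diagMatrix zero (squaresPart f) r s
  itemSum-squareItems (inj₁ _)             r s = sym (zeroʳ _)
  itemSum-squareItems (inj₂ (p₀ , ps , _)) r s = begin
    E ⊗ (1ₚ ⊗ (p₀ ⊗ p₀)) ⊕ itemSum (tabulate (λ k → diag zero (x k) (ps k))) r s
      ≡⟨ ≡.cong (E ⊗ (1ₚ ⊗ (p₀ ⊗ p₀)) ⊕_) (itemSum-tabulate (λ k → diag zero (x k) (ps k)) r s) ⟩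
    E ⊗ (1ₚ ⊗ (p₀ ⊗ p₀)) ⊕ ∑[ k < m ] (E ⊗ (var k ⊗ (ps k ⊗ ps k)))
      ≈⟨ +-congˡ (*-distribˡ-sum E (λ k → var k ⊗ (ps k ⊗ ps k))) ⟨
    E ⊗ (1ₚ ⊗ (p₀ ⊗ p₀)) ⊕ E ⊗ ∑[ k < m ] (var k ⊗ (ps k ⊗ ps k))
      ≈⟨ solve 3 (λ E p σ → E :* (κ 1 :* (p :* p)) :+ E :* σ := E :* (p :* p :+ σ)) refl E p₀ _ ⟩
    E ⊗ (p₀ ⊗ p₀ ⊕ ∑[ k < m ] (var k ⊗ (ps k ⊗ ps k))) ∎
    where
    E = ε zero r ⊗ ε zero s

  initialItems : ∀ {n} (M : Matrix n) → (∀ i → DiagonalForm (M i i)) → List (Item n)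
  initialItems {zero}  M forms = []
  initialItems {suc n} M forms = squareItems (forms zero)
                              ++ tabulate (λ j → edge zero (suc j) (M zero (suc j)))
                              ++ map ↑ (initialItems (minor zero M) (forms ∘ suc))

  initialEntries : ∀ {n} (M : Matrix n) → (∀ i → DiagonalForm (M i i)) → EntryMatrix n
  initialEntries M forms r s = εₑ r s (constantPart (forms r))

  firstRow-decomposition : ∀ {n} (M : Matrix (suc n)) → Symmetric M → (c : Fin (suc n) → Poly) (D : Poly) (ts : List (Item n)) →
    D ≈ₚ M zero zero ⊕ c zero → (∀ r s → itemSum ts r s ≈ₚ M (suc r) (suc s) ⊕ ε r s ⊗ c (suc r)) →
    ∀ r s → diagMatrix zero D r s ⊕ (∑[ j < n ] edgeMatrix zero (suc j) (M zero (suc j)) r s ⊕ itemSum (map ↑ ts) r s) ≈ₚ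
            M r s ⊕ ε r s ⊗ c r
  firstRow-decomposition {n} M M-sym c D ts D≈ ts≈ zero zero = begin
    (1ₚ ⊗ 1ₚ) ⊗ D ⊕ (∑[ j < n ] ((1ₚ ⊗ 0ₚ ⊕ 0ₚ ⊗ 1ₚ) ⊗ w j) ⊕ itemSum (map ↑ ts) zero zero)
      ≈⟨ +-congˡ (+-cong (sum-≈0 (λ j → solve 1 (λ w → (κ 1 :* κ 0 :+ κ 0 :* κ 1) :* w := κ 0) refl (w j)))
                         (itemSum-↑-row₀ ts zero)) ⟩
    (1ₚ ⊗ 1ₚ) ⊗ D ⊕ (0ₚ ⊕ 0ₚ)        ≈⟨ solve 1 (λ D → (κ 1 :* κ 1) :* D :+ (κ 0 :+ κ 0) := D) refl D ⟩
    D                                ≈⟨ D≈ ⟩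
    M zero zero ⊕ c zero             ≈⟨ +-congˡ (*-identityˡ _) ⟨
    M zero zero ⊕ 1ₚ ⊗ c zero        ∎
    where w = λ j → M zero (suc j)
  firstRow-decomposition {n} M M-sym c D ts D≈ ts≈ zero (suc s) = begin
    (1ₚ ⊗ 0ₚ) ⊗ D ⊕ (∑[ j < n ] ((1ₚ ⊗ ε j s ⊕ 0ₚ ⊗ 0ₚ) ⊗ w j) ⊕ itemSum (map ↑ ts) zero (suc s))
      ≈⟨ +-congˡ (+-cong (sum-cong-≋ (λ j → solve 2 (λ e w → (κ 1 :* e :+ κ 0 :* κ 0) :* w := e :* w) refl (ε j s) (w j)))
                         (itemSum-↑-row₀ ts (suc s))) ⟩
    (1ₚ ⊗ 0ₚ) ⊗ D ⊕ (∑[ j < n ] (ε j s ⊗ w j) ⊕ 0ₚ)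
      ≈⟨ +-congˡ (+-congʳ (∑-ε w s)) ⟩
    (1ₚ ⊗ 0ₚ) ⊗ D ⊕ (w s ⊕ 0ₚ)
      ≈⟨ solve 3 (λ D w c → (κ 1 :* κ 0) :* D :+ (w :+ κ 0) := w :+ κ 0 :* c) refl D (w s) (c zero) ⟩
    M zero (suc s) ⊕ 0ₚ ⊗ c zero                      ∎
    where w = λ j → M zero (suc j)
  firstRow-decomposition {n} M M-sym c D ts D≈ ts≈ (suc r) zero = begin
    (0ₚ ⊗ 1ₚ) ⊗ D ⊕ (∑[ j < n ] ((0ₚ ⊗ 0ₚ ⊕ ε j r ⊗ 1ₚ) ⊗ w j) ⊕ itemSum (map ↑ ts) (suc r) zero)
      ≈⟨ +-congˡ (+-cong (sum-cong-≋ (λ j → solve 2 (λ e w → (κ 0 :* κ 0 :+ e :* κ 1) :* w := e :* w) refl (ε j r) (w j)))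
                         (itemSum-↑-column₀ ts (suc r))) ⟩
    (0ₚ ⊗ 1ₚ) ⊗ D ⊕ (∑[ j < n ] (ε j r ⊗ w j) ⊕ 0ₚ)
      ≈⟨ +-congˡ (+-congʳ (trans (∑-ε w r) (M-sym zero (suc r)))) ⟩
    (0ₚ ⊗ 1ₚ) ⊗ D ⊕ (M (suc r) zero ⊕ 0ₚ)
      ≈⟨ solve 3 (λ D w c → (κ 0 :* κ 1) :* D :+ (w :+ κ 0) := w :+ κ 0 :* c) refl D _ (c (suc r)) ⟩
    M (suc r) zero ⊕ 0ₚ ⊗ c (suc r)                   ∎
    where w = λ j → M zero (suc j)
  firstRow-decomposition {n} M M-sym c D ts D≈ ts≈ (suc r) (suc s) = begin
    (0ₚ ⊗ 0ₚ) ⊗ D ⊕ (∑[ j < n ] ((0ₚ ⊗ ε j s ⊕ ε j r ⊗ 0ₚ) ⊗ w j) ⊕ itemSum (map ↑ ts) (suc r) (suc s))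
      ≈⟨ +-cong (solve 1 (λ D → (κ 0 :* κ 0) :* D := κ 0) refl D)
                (+-cong (sum-≈0 (λ j → solve 3 (λ e e′ w → (κ 0 :* e :+ e′ :* κ 0) :* w := κ 0)
                                                refl (ε j s) (ε j r) (w j)))
                        (reflexive (itemSum-↑ ts r s))) ⟩
    0ₚ ⊕ (0ₚ ⊕ itemSum ts r s)           ≈⟨ trans (+-identityˡ _) (+-identityˡ _) ⟩
    itemSum ts r s                       ≈⟨ ts≈ r s ⟩
    M (suc r) (suc s) ⊕ ε r s ⊗ c (suc r) ∎
    where w = λ j → M zero (suc j)

  -- From a representation to a gSDR

  var-isWeightedSumOfSquares : ∀ k → WeightedSumOfSquares (var k)
  var-isWeightedSumOfSquares k = 0ₚ , ε k , (begin
    var k                                          ≈⟨ ∑-ε var k ⟨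
    ∑[ i < m ] (ε i k ⊗ var i)                     ≈⟨ sum-cong-≋ (λ i → trans (*-comm _ _) (*-congˡ (ε≈ε² i))) ⟩
    ∑[ i < m ] (var i ⊗ (ε k i ⊗ ε k i))           ≡⟨ Σ[]≡sum (λ i → var i ⊗ (ε k i ⊗ ε k i)) ⟨
    Σ[ (λ i → var i ⊗ (ε k i ⊗ ε k i)) ]           ≈⟨ +-identityˡ _ ⟨
    0ₚ ⊕ Σ[ (λ i → var i ⊗ (ε k i ⊗ ε k i)) ]      ≈⟨ +-congʳ (zeroˡ 0ₚ) ⟨
    0ₚ ⊗ 0ₚ ⊕ Σ[ (λ i → var i ⊗ (ε k i ⊗ ε k i)) ] ∎)
    where
    ε≈ε² : ∀ i → ε i k ≈ₚ ε k i ⊗ ε k i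
    ε≈ε² i = trans (reflexive (ε-sym i k)) (sym (ε-idem k i))

  entry-isDiagonalForm : ∀ e → IsConstant ⟦ e ⟧ₑ ⊎ WeightedSumOfSquares ⟦ e ⟧ₑ
  entry-isDiagonalForm (cst a) = inj₁ (a , ≈-refl)
  entry-isDiagonalForm (x k)   = inj₂ (var-isWeightedSumOfSquares k)

  representable-cong : ∀ {P Q} → P ≈ₚ Q → Representable P → Representable Q
  representable-cong P≈Q (n , E , E-sym , detE≈P) = n , E , E-sym , trans detE≈P P≈Q

  representable⇒hasGSDR : ∀ {P} → Representable P → HasGSDR P
  representable⇒hasGSDR (n , E , E-sym , detE≈P) =
    n , (λ i j → ⟦ E i j ⟧ₑ) , E-sym , detE≈P , λ i → entry-isDiagonalForm (E i i)

module InCharacteristic2 {c ℓ} (F : Field c ℓ) (char2 : Char2 F) (m : ℕ) where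
  open Polynomials F m
  open Field F using () renaming (0# to 0F; 1# to 1F; _+_ to _+F_)

  x⊕x≈0 : ∀ p → p ⊕ p ≈ₚ 0ₚ
  x⊕x≈0 p = begin
    p ⊕ p                 ≈⟨ +-cong (*-identityˡ p) (*-identityˡ p) ⟨
    1ₚ ⊗ p ⊕ 1ₚ ⊗ p       ≈⟨ distribʳ p 1ₚ 1ₚ ⟨
    (1ₚ ⊕ 1ₚ) ⊗ p         ≈⟨ *-congʳ (con-+ 1F 1F) ⟨
    con (1F +F 1F) ⊗ p    ≈⟨ *-congʳ (con-cong char2) ⟩
    0ₚ ⊗ p                ≈⟨ zeroˡ p ⟩
    0ₚ                    ∎

  ⊝p≈p : ∀ p → ⊝ p ≈ₚ p
  ⊝p≈p p = begin
    ⊝ p               ≈⟨ +-identityʳ (⊝ p) ⟨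
    ⊝ p ⊕ 0ₚ          ≈⟨ +-congˡ (x⊕x≈0 p) ⟨
    ⊝ p ⊕ (p ⊕ p)     ≈⟨ +-assoc (⊝ p) p p ⟨
    (⊝ p ⊕ p) ⊕ p     ≈⟨ +-congʳ (⊝-invˡ p) ⟩
    0ₚ ⊕ p            ≈⟨ +-identityˡ p ⟩
    p                 ∎

  signℕ≈1 : ∀ k → signℕ k ≈ₚ 1ₚ
  signℕ≈1 zero    = refl
  signℕ≈1 (suc k) = trans (⊝p≈p _) (signℕ≈1 k)

  det-expand : ∀ {n} (M : Matrix (suc n)) → det M ≈ₚ ∑[ j < suc n ] (M zero j ⊗ det (minor j M))
  det-expand {n} M = begin
    det M                                                    ≡⟨ Σ[]≡sum (λ j → sign j ⊗ M zero j ⊗ det (minor j M)) ⟩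
    ∑[ j < suc n ] (sign j ⊗ M zero j ⊗ det (minor j M))     ≈⟨ sum-cong-≋ unsigned ⟩
    ∑[ j < suc n ] (M zero j ⊗ det (minor j M))              ∎
    where
    unsigned : ∀ j → sign j ⊗ M zero j ⊗ det (minor j M) ≈ₚ M zero j ⊗ det (minor j M)
    unsigned j = *-congʳ (trans (*-congʳ (signℕ≈1 (toℕ j))) (*-identityˡ _))

  det-cong : ∀ {n} {M N : Matrix n} → (∀ r s → M r s ≈ₚ N r s) → det M ≈ₚ det N
  det-cong {zero}  _ = refl
  det-cong {suc n} {M} {N} M≈N = begin
    det M                                         ≈⟨ det-expand M ⟩
    ∑[ j < suc n ] (M zero j ⊗ det (minor j M))   ≈⟨ sum-cong-≋ terms ⟩
    ∑[ j < suc n ] (N zero j ⊗ det (minor j N))   ≈⟨ det-expand N ⟨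
    det N                                         ∎
    where
    terms : ∀ j → M zero j ⊗ det (minor j M) ≈ₚ N zero j ⊗ det (minor j N)
    terms j = *-cong (M≈N zero j) (det-cong λ r s → M≈N (suc r) (punchIn j s))

  det-minors≈0 : ∀ {n} (M : Matrix (suc n)) → (∀ j → det (minor j M) ≈ₚ 0ₚ) → det M ≈ₚ 0ₚ
  det-minors≈0 M minors≈0 = trans (det-expand M) (sum-≈0 λ j → trans (*-congˡ (minors≈0 j)) (zeroʳ (M zero j)))

  det-zeroFirstColumn : ∀ {n} (M : Matrix (suc n)) → (∀ r → M r zero ≈ₚ 0ₚ) → det M ≈ₚ 0ₚ
  det-zeroFirstColumn {zero} M col≈0 =
    trans (det-expand M) (trans (+-identityʳ _) (trans (*-congʳ (col≈0 zero)) (zeroˡ _)))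
  det-zeroFirstColumn {suc n} M col≈0 =
    trans (det-expand M) (trans (+-cong (trans (*-congʳ (col≈0 zero)) (zeroˡ _)) (sum-≈0 later)) (+-identityˡ 0ₚ))
    where
    later : ∀ j → M zero (suc j) ⊗ det (minor (suc j) M) ≈ₚ 0ₚ
    later j = trans (*-congˡ (det-zeroFirstColumn (minor (suc j) M) (col≈0 ∘ suc))) (zeroʳ _)

  det-firstColumnVanishingBelow : ∀ {n} (M : Matrix (suc n)) → (∀ r → M (suc r) zero ≈ₚ 0ₚ) →
                    det M ≈ₚ M zero zero ⊗ det (minor zero M)
  det-firstColumnVanishingBelow {zero}  M below≈0 = trans (det-expand M) (+-identityʳ _)
  det-firstColumnVanishingBelow {suc n} M below≈0 = trans (det-expand M) (trans (+-congˡ (sum-≈0 later)) (+-identityʳ _))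
    where
    later : ∀ j → M zero (suc j) ⊗ det (minor (suc j) M) ≈ₚ 0ₚ
    later j = trans (*-congˡ (det-zeroFirstColumn (minor (suc j) M) below≈0)) (zeroʳ _)

  det-twoColumnsVanishingBelow : ∀ {n} (M : Matrix (suc (suc n))) →
    (∀ r → M (suc r) zero ≈ₚ 0ₚ) → (∀ r → M (suc r) (suc zero) ≈ₚ 0ₚ) → det M ≈ₚ 0ₚ
  det-twoColumnsVanishingBelow M col₀≈0 col₁≈0 =
    trans (det-firstColumnVanishingBelow M col₀≈0)
          (trans (*-congˡ (det-zeroFirstColumn (minor zero M) col₁≈0)) (zeroʳ _))

  det-blockTriangular : ∀ {n} (M : Matrix (suc (suc n))) →
    (∀ r → M (suc (suc r)) zero ≈ₚ 0ₚ) → (∀ r → M (suc (suc r)) (suc zero) ≈ₚ 0ₚ) →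
    det M ≈ₚ (M zero zero ⊗ M (suc zero) (suc zero) ⊕ M zero (suc zero) ⊗ M (suc zero) zero) ⊗ det (lowerRight M)
  det-blockTriangular {n} M col₀≈0 col₁≈0 = begin
    det M
      ≈⟨ det-expand M ⟩
    M₀₀ ⊗ det (minor zero M) ⊕ (M₀₁ ⊗ det (minor (suc zero) M) ⊕ ∑[ k < n ] far k)
      ≈⟨ +-cong (*-congˡ (det-firstColumnVanishingBelow (minor zero M) col₁≈0))
                (+-cong (*-congˡ (det-firstColumnVanishingBelow (minor (suc zero) M) col₀≈0)) (sum-≈0 (far≈0 M col₀≈0 col₁≈0))) ⟩
    M₀₀ ⊗ (M₁₁ ⊗ D) ⊕ (M₀₁ ⊗ (M₁₀ ⊗ D) ⊕ 0ₚ)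
      ≈⟨ solve 5 (λ a b c d D → a :* (d :* D) :+ (b :* (c :* D) :+ κ 0) := (a :* d :+ b :* c) :* D) refl M₀₀ M₀₁ M₁₀ M₁₁ D ⟩
    (M₀₀ ⊗ M₁₁ ⊕ M₀₁ ⊗ M₁₀) ⊗ D
      ∎
    where
    M₀₀ = M zero zero
    M₀₁ = M zero (suc zero)
    M₁₀ = M (suc zero) zero
    M₁₁ = M (suc zero) (suc zero)
    D = det (lowerRight M)
    far : Fin n → Poly
    far k = M zero (suc (suc k)) ⊗ det (minor (suc (suc k)) M)
    far≈0 : ∀ {n} (M : Matrix (suc (suc n))) → (∀ r → M (suc (suc r)) zero ≈ₚ 0ₚ) →
            (∀ r → M (suc (suc r)) (suc zero) ≈ₚ 0ₚ) → ∀ k → M zero (suc (suc k)) ⊗ det (minor (suc (suc k)) M) ≈ₚ 0ₚ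
    far≈0 {suc n} M col₀≈0 col₁≈0 k =
      trans (*-congˡ (det-twoColumnsVanishingBelow (minor (suc (suc k)) M) col₀≈0 col₁≈0)) (zeroʳ _)

  ∑≢-symmetric≈0 : ∀ {n} (G : Fin (suc n) → Fin (suc n) → Poly) → (∀ i j → G i j ≈ₚ G j i) → ∑≢ G ≈ₚ 0ₚ
  ∑≢-symmetric≈0 {zero}  G _ = +-identityˡ 0ₚ
  ∑≢-symmetric≈0 {suc n} G G-sym = begin
    ∑≢ G                                                 ≈⟨ ∑≢-split G ⟩
    A ⊕ (∑[ k < suc n ] G (suc k) zero ⊕ ∑≢ G↓)
      ≈⟨ +-congˡ (+-cong (sum-cong-≋ (λ k → G-sym (suc k) zero)) (∑≢-symmetric≈0 G↓ (λ i j → G-sym (suc i) (suc j)))) ⟩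
    A ⊕ (A ⊕ 0ₚ)                                         ≈⟨ +-congˡ (+-identityʳ A) ⟩
    A ⊕ A                                                ≈⟨ x⊕x≈0 A ⟩
    0ₚ                                                   ∎
    where
    A = ∑[ k < suc n ] G zero (suc k)
    G↓ = λ i j → G (suc i) (suc j)

  det-minor₂-comm : ∀ {n} (M : Matrix (suc (suc n))) i j → det (minor₂ i j M) ≈ₚ det (minor₂ j i M)
  det-minor₂-comm M i j = det-cong λ r s → reflexive (≡.cong (M (suc (suc r))) (punchIn₂-comm i j s))

  det-expand₂ : ∀ {n} (M : Matrix (suc (suc n))) →
    det M ≈ₚ ∑≢ (λ i j → M zero i ⊗ (M (suc zero) j ⊗ det (minor₂ i j M)))
  det-expand₂ M = trans (det-expand M) (sum-cong-≋ expandMinor)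
    where
    expandMinor : ∀ i → M zero i ⊗ det (minor i M) ≈ₚ
                        ∑[ k < _ ] (M zero i ⊗ (M (suc zero) (punchIn i k) ⊗ det (minor₂ i (punchIn i k) M)))
    expandMinor i = begin
      M zero i ⊗ det (minor i M)
        ≈⟨ *-congˡ (det-expand (minor i M)) ⟩
      M zero i ⊗ ∑[ k < _ ] (M (suc zero) (punchIn i k) ⊗ det (minor k (minor i M)))
        ≈⟨ *-distribˡ-sum (M zero i) (λ k → M (suc zero) (punchIn i k) ⊗ det (minor k (minor i M))) ⟩
      ∑[ k < _ ] (M zero i ⊗ (M (suc zero) (punchIn i k) ⊗ det (minor k (minor i M))))
        ≈⟨ sum-cong-≋ regroup ⟩
      ∑[ k < _ ] (M zero i ⊗ (M (suc zero) (punchIn i k) ⊗ det (minor₂ i (punchIn i k) M)))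
        ∎
      where
      regroup : ∀ k → M zero i ⊗ (M (suc zero) (punchIn i k) ⊗ det (minor k (minor i M))) ≈ₚ
                      M zero i ⊗ (M (suc zero) (punchIn i k) ⊗ det (minor₂ i (punchIn i k) M))
      regroup k = *-congˡ (*-congˡ (det-cong λ r s → reflexive (≡.cong (M (suc (suc r))) (punchIn-punchIn i k s))))

  det-swapRows01 : ∀ {n} (M : Matrix (suc (suc n))) → det (M ∘ swap01) ≈ₚ det M
  det-swapRows01 M = begin
    det (M ∘ swap01)                                                ≈⟨ det-expand₂ (M ∘ swap01) ⟩
    ∑≢ (λ i j → M (suc zero) i ⊗ (M zero j ⊗ det (minor₂ i j M)))   ≈⟨ ∑≢-cong swapped ⟩
    ∑≢ (λ i j → G j i)                                              ≈⟨ ∑≢-transpose G ⟨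
    ∑≢ G                                                            ≈⟨ det-expand₂ M ⟨
    det M                                                           ∎
    where
    G = λ i j → M zero i ⊗ (M (suc zero) j ⊗ det (minor₂ i j M))
    swapped : ∀ i j → M (suc zero) i ⊗ (M zero j ⊗ det (minor₂ i j M)) ≈ₚ G j i
    swapped i j = trans (solve 3 (λ a b d → a :* (b :* d) := b :* (a :* d)) refl _ _ _)
                        (*-congˡ (*-congˡ (det-minor₂-comm M i j)))

  det-equalRows01 : ∀ {n} (M : Matrix (suc (suc n))) → (∀ s → M zero s ≈ₚ M (suc zero) s) → det M ≈ₚ 0ₚ
  det-equalRows01 M rows≈ = trans (det-expand₂ M) (∑≢-symmetric≈0 G G-sym)
    where
    G = λ i j → M zero i ⊗ (M (suc zero) j ⊗ det (minor₂ i j M))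
    G-sym : ∀ i j → G i j ≈ₚ G j i
    G-sym i j = begin
      M zero i ⊗ (M (suc zero) j ⊗ det (minor₂ i j M))
        ≈⟨ *-cong (rows≈ i) (*-cong (sym (rows≈ j)) (det-minor₂-comm M i j)) ⟩
      M (suc zero) i ⊗ (M zero j ⊗ det (minor₂ j i M))
        ≈⟨ solve 3 (λ a b d → a :* (b :* d) := b :* (a :* d)) refl _ _ _ ⟩
      M zero j ⊗ (M (suc zero) i ⊗ det (minor₂ j i M))   ∎

  det-equalRow0 : ∀ {n} (M : Matrix (suc n)) j → (∀ s → M zero s ≈ₚ M (suc j) s) → det M ≈ₚ 0ₚ
  det-equalRow0 M zero rows≈ = det-equalRows01 M rows≈
  det-equalRow0 {suc (suc n)} M (suc j) rows≈ =
    -- once rows 0 and 1 are swapped, every minor along the new row 0 contains the old row 0 twice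
    trans (sym (det-swapRows01 M))
          (det-minors≈0 (M ∘ swap01) λ k → det-equalRow0 (minor k (M ∘ swap01)) j (rows≈ ∘ punchIn k))

  det-equalRows : ∀ {n} (M : Matrix n) {i j} → i ≢ j → (∀ s → M i s ≈ₚ M j s) → det M ≈ₚ 0ₚ
  det-equalRows M {zero}  {zero}  i≢j _     = contradiction ≡.refl i≢j
  det-equalRows M {zero}  {suc j} _   rows≈ = det-equalRow0 M j rows≈
  det-equalRows M {suc i} {zero}  _   rows≈ = det-equalRow0 M i (sym ∘ rows≈)
  det-equalRows {suc n} M {suc i} {suc j} i≢j rows≈ =
    det-minors≈0 M λ k → det-equalRows (minor k M) (i≢j ∘ ≡.cong suc) (rows≈ ∘ punchIn k)

  det-expansionLinear : ∀ {n} {X Y Z : Matrix (suc n)} a →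
    (∀ j → Z zero j ⊗ det (minor j Z) ≈ₚ X zero j ⊗ det (minor j X) ⊕ a ⊗ (Y zero j ⊗ det (minor j Y))) →
    det Z ≈ₚ det X ⊕ a ⊗ det Y
  det-expansionLinear {n} {X} {Y} {Z} a terms = begin
    det Z                                        ≈⟨ det-expand Z ⟩
    ∑[ j < suc n ] (Z zero j ⊗ det (minor j Z))  ≈⟨ sum-cong-≋ terms ⟩
    ∑[ j < suc n ] (X zero j ⊗ det (minor j X) ⊕ a ⊗ (Y zero j ⊗ det (minor j Y)))
      ≈⟨ ∑-linear (λ j → X zero j ⊗ det (minor j X)) a (λ j → Y zero j ⊗ det (minor j Y)) ⟩
    ∑[ j < suc n ] (X zero j ⊗ det (minor j X)) ⊕ a ⊗ ∑[ j < suc n ] (Y zero j ⊗ det (minor j Y))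
      ≈⟨ +-cong (det-expand X) (*-congˡ (det-expand Y)) ⟨
    det X ⊕ a ⊗ det Y                            ∎

  det-linearInRow : ∀ {n} (k : Fin n) {X Y Z : Matrix n} a →
    (∀ r → r ≢ k → ∀ s → Y r s ≈ₚ X r s) → (∀ r → r ≢ k → ∀ s → Z r s ≈ₚ X r s) →
    (∀ s → Z k s ≈ₚ X k s ⊕ a ⊗ Y k s) → det Z ≈ₚ det X ⊕ a ⊗ det Y
  det-linearInRow {suc n} zero {X} {Y} {Z} a Y≈X Z≈X rowₖ = det-expansionLinear {X = X} {Y} {Z} a expandRow
    where
    sameMinor : ∀ {W} → (∀ r → r ≢ zero → ∀ s → W r s ≈ₚ X r s) → ∀ j → det (minor j W) ≈ₚ det (minor j X)
    sameMinor W≈X j = det-cong λ r s → W≈X (suc r) (λ ()) (punchIn j s)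
    expandRow : ∀ j → Z zero j ⊗ det (minor j Z) ≈ₚ X zero j ⊗ det (minor j X) ⊕ a ⊗ (Y zero j ⊗ det (minor j Y))
    expandRow j = begin
      Z zero j ⊗ det (minor j Z)
        ≈⟨ *-cong (rowₖ j) (sameMinor Z≈X j) ⟩
      (X zero j ⊕ a ⊗ Y zero j) ⊗ det (minor j X)
        ≈⟨ solve 4 (λ x a y d → (x :+ a :* y) :* d := x :* d :+ a :* (y :* d)) refl _ _ _ _ ⟩
      X zero j ⊗ det (minor j X) ⊕ a ⊗ (Y zero j ⊗ det (minor j X))
        ≈⟨ +-congˡ (*-congˡ (*-congˡ (sameMinor Y≈X j))) ⟨
      X zero j ⊗ det (minor j X) ⊕ a ⊗ (Y zero j ⊗ det (minor j Y))
        ∎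
  det-linearInRow {suc n} (suc k) {X} {Y} {Z} a Y≈X Z≈X rowₖ = det-expansionLinear {X = X} {Y} {Z} a expandRow
    where
    minorₖ : ∀ j → det (minor j Z) ≈ₚ det (minor j X) ⊕ a ⊗ det (minor j Y)
    minorₖ j = det-linearInRow k a (λ r r≢k s → Y≈X (suc r) (r≢k ∘ suc-injective) (punchIn j s))
                                   (λ r r≢k s → Z≈X (suc r) (r≢k ∘ suc-injective) (punchIn j s)) (rowₖ ∘ punchIn j)
    expandRow : ∀ j → Z zero j ⊗ det (minor j Z) ≈ₚ X zero j ⊗ det (minor j X) ⊕ a ⊗ (Y zero j ⊗ det (minor j Y))
    expandRow j = begin
      Z zero j ⊗ det (minor j Z)
        ≈⟨ *-cong (Z≈X zero (λ ()) j) (minorₖ j) ⟩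
      X zero j ⊗ (det (minor j X) ⊕ a ⊗ det (minor j Y))
        ≈⟨ solve 4 (λ x a d e → x :* (d :+ a :* e) := x :* d :+ a :* (x :* e)) refl _ _ _ _ ⟩
      X zero j ⊗ det (minor j X) ⊕ a ⊗ (X zero j ⊗ det (minor j Y))
        ≈⟨ +-congˡ (*-congˡ (*-congʳ (Y≈X zero (λ ()) j))) ⟨
      X zero j ⊗ det (minor j X) ⊕ a ⊗ (Y zero j ⊗ det (minor j Y))
        ∎

  det-addScaledRow : ∀ {n} (M : Matrix n) {k j} a → j ≢ k → det (addScaledRow k a j M) ≈ₚ det M
  det-addScaledRow M {k} {j} a j≢k = begin
    det (addScaledRow k a j M)  ≈⟨ det-linearInRow k a Y≈M (λ r r≢k → addScaledRow-other a j M r≢k) rowₖ ⟩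
    det M ⊕ a ⊗ det Y           ≈⟨ +-congˡ (*-congˡ (det-equalRows Y j≢k rowsⱼₖ)) ⟩
    det M ⊕ a ⊗ 0ₚ              ≈⟨ +-congˡ (zeroʳ a) ⟩
    det M ⊕ 0ₚ                  ≈⟨ +-identityʳ _ ⟩
    det M                       ∎
    where
    Y = updateAt M k (λ _ → M j)
    Yₖ : Y k ≡ M j
    Yₖ = updateAt-updates k M
    Y≈M : ∀ r → r ≢ k → ∀ s → Y r s ≈ₚ M r s
    Y≈M r r≢k s = reflexive (≡.cong (λ row → row s) (updateAt-minimal r k M r≢k))
    rowsⱼₖ : ∀ s → Y j s ≈ₚ Y k s
    rowsⱼₖ s = reflexive (≡.cong (λ row → row s) (≡.trans (updateAt-minimal j k M j≢k) (≡.sym Yₖ)))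
    rowₖ : ∀ s → addScaledRow k a j M k s ≈ₚ M k s ⊕ a ⊗ Y k s
    rowₖ s = begin
      M k s ⊕ ε k k ⊗ (a ⊗ M j s)  ≡⟨ ≡.cong (λ e → M k s ⊕ e ⊗ (a ⊗ M j s)) (ε-diag k) ⟩
      M k s ⊕ 1ₚ ⊗ (a ⊗ M j s)     ≈⟨ +-congˡ (*-identityˡ _) ⟩
      M k s ⊕ a ⊗ M j s            ≡⟨ ≡.cong (λ row → M k s ⊕ a ⊗ row s) Yₖ ⟨
      M k s ⊕ a ⊗ Y k s            ∎

  det-clearBorderColumns : ∀ {n} (i j : Fin n) d p q N → det (clearBorderColumns i j d p q N) ≈ₚ det N
  det-clearBorderColumns i j d p q N =
    trans (det-addScaledRow N₂ {suc (suc j)} {zero} q (λ ()))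
          (trans (det-addScaledRow N₁ {suc (suc i)} {suc zero} p (λ ()))
                 (det-addScaledRow N {suc (suc i)} {zero} (p ⊗ d) (λ ())))
    where
    N₁ = addScaledRow (suc (suc i)) (p ⊗ d) zero N
    N₂ = addScaledRow (suc (suc i)) p (suc zero) N₁

  -- The Schur complement of the border, for u = p eᵢ and v = q eⱼ.
  det-border : ∀ {n} (M : Matrix n) d (i j : Fin n) p q →
    det (border M d (λ k → ε i k ⊗ p) (λ k → ε j k ⊗ q)) ≈ₚ
    det (λ r s → M r s ⊕ (edgeMatrix i j (p ⊗ q) r s ⊕ diagMatrix i (d ⊗ (p ⊗ p)) r s))
  det-border M d i j p q = begin
    det N      ≈⟨ det-clearBorderColumns i j d p q N ⟨
    det N′     ≈⟨ det-blockTriangular N′ column₀ column₁ ⟩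
    (N′ zero zero ⊗ N′ (suc zero) (suc zero) ⊕ N′ zero (suc zero) ⊗ N′ (suc zero) zero) ⊗ det (lowerRight N′)
               ≈⟨ *-cong corner (det-cong lower) ⟩
    1ₚ ⊗ det (λ r s → M r s ⊕ (edgeMatrix i j (p ⊗ q) r s ⊕ diagMatrix i (d ⊗ (p ⊗ p)) r s))
               ≈⟨ *-identityˡ _ ⟩
    det (λ r s → M r s ⊕ (edgeMatrix i j (p ⊗ q) r s ⊕ diagMatrix i (d ⊗ (p ⊗ p)) r s)) ∎
    where
    N = border M d (λ k → ε i k ⊗ p) (λ k → ε j k ⊗ q)
    N′ = clearBorderColumns i j d p q N
    row₀ = clearBorderColumns-top i j d p q N {zero} (λ _ ())
    row₁ = clearBorderColumns-top i j d p q N {suc zero} (λ _ ())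
    corner : N′ zero zero ⊗ N′ (suc zero) (suc zero) ⊕ N′ zero (suc zero) ⊗ N′ (suc zero) zero ≈ₚ 1ₚ
    corner = trans (+-cong (*-cong (row₀ zero) (row₁ (suc zero))) (*-cong (row₀ (suc zero)) (row₁ zero)))
                   (solve 1 (λ d → κ 0 :* d :+ κ 1 :* κ 1 := κ 1) refl d)
    column₀ : ∀ r → N′ (suc (suc r)) zero ≈ₚ 0ₚ
    column₀ r = trans (clearBorderColumns-lower i j d p q N r zero)
      (trans (solve 5 (λ e f p d q → e :* p :+ (e :* (p :* d :* κ 0 :+ p :* κ 1) :+ f :* (q :* κ 0)) := e :* p :+ e :* p)
                      refl (ε i r) (ε j r) p d q)
             (x⊕x≈0 _))
    column₁ : ∀ r → N′ (suc (suc r)) (suc zero) ≈ₚ 0ₚ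
    column₁ r = trans (clearBorderColumns-lower i j d p q N r (suc zero))
      (trans (solve 5 (λ e f p d q → f :* q :+ (e :* (p :* d :* κ 1 :+ p :* d) :+ f :* (q :* κ 1))
                                   := (f :* q :+ f :* q) :+ (e :* (p :* d) :+ e :* (p :* d)))
                      refl (ε i r) (ε j r) p d q)
             (trans (+-cong (x⊕x≈0 _) (x⊕x≈0 _)) (+-identityˡ 0ₚ)))
    lower : ∀ r s → lowerRight N′ r s ≈ₚ M r s ⊕ (edgeMatrix i j (p ⊗ q) r s ⊕ diagMatrix i (d ⊗ (p ⊗ p)) r s)
    lower r s = trans (clearBorderColumns-lower i j d p q N r (suc (suc s)))
      (solve 8 (λ x eᵢ eⱼ eᵢ′ eⱼ′ p d q → x :+ (eᵢ :* (p :* d :* (eᵢ′ :* p) :+ p :* (eⱼ′ :* q)) :+ eⱼ :* (q :* (eᵢ′ :* p)))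
                                       := x :+ ((eᵢ :* eⱼ′ :+ eⱼ :* eᵢ′) :* (p :* q) :+ (eᵢ :* eᵢ′) :* (d :* (p :* p))))
             refl (M r s) (ε i r) (ε j r) (ε i s) (ε j s) p d q)

  -- Reduction of the pending corrections

  det-realise-atomic : ∀ {n} (B : EntryMatrix n) i j e ts →
    det (realise (borderE B (cst 0F) (λ k → εₑ i k (cst 1F)) (λ k → εₑ j k e)) (shift₂ ts)) ≈ₚ
    det (realise B (edge i j ⟦ e ⟧ₑ ∷ ts))
  det-realise-atomic B i j e ts = begin
    det (realise (borderE B (cst 0F) (λ k → εₑ i k (cst 1F)) (λ k → εₑ j k e)) (shift₂ ts))
      ≈⟨ det-cong (λ r s → trans (realise-borderE B _ _ _ ts r s) (border-cong X 0ₚ (λ k → ⟦εₑ⟧ i k (cst 1F)) (λ k → ⟦εₑ⟧ j k e) r s)) ⟩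
    det (border X 0ₚ (λ k → ε i k ⊗ 1ₚ) (λ k → ε j k ⊗ ⟦ e ⟧ₑ))
      ≈⟨ det-border X 0ₚ i j 1ₚ ⟦ e ⟧ₑ ⟩
    det (λ r s → X r s ⊕ (edgeMatrix i j (1ₚ ⊗ ⟦ e ⟧ₑ) r s ⊕ diagMatrix i (0ₚ ⊗ (1ₚ ⊗ 1ₚ)) r s))
      ≈⟨ det-cong regroup ⟩
    det (realise B (edge i j ⟦ e ⟧ₑ ∷ ts)) ∎
    where
    X = realise B ts
    regroup : ∀ r s → X r s ⊕ (edgeMatrix i j (1ₚ ⊗ ⟦ e ⟧ₑ) r s ⊕ diagMatrix i (0ₚ ⊗ (1ₚ ⊗ 1ₚ)) r s) ≈ₚ
                      realise B (edge i j ⟦ e ⟧ₑ ∷ ts) r s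
    regroup r s = solve 6 (λ b σ E a a′ w → (b :+ σ) :+ (E :* (κ 1 :* w) :+ (a :* a′) :* (κ 0 :* (κ 1 :* κ 1)))
                                          := b :+ (E :* w :+ σ))
                        refl ⟦ B r s ⟧ₑ (itemSum ts r s) (ε i r ⊗ ε j s ⊕ ε j r ⊗ ε i s) (ε i r) (ε i s) ⟦ e ⟧ₑ

  det-realise-twoEdges : ∀ {n} (B : EntryMatrix n) d i j p q ts →
    det (realise (borderE B d (λ _ → cst 0F) (λ _ → cst 0F))
                 (edge zero (suc (suc i)) p ∷ edge (suc zero) (suc (suc j)) q ∷ shift₂ ts)) ≈ₚ
    det (λ r s → realise B ts r s ⊕ (edgeMatrix i j (p ⊗ q) r s ⊕ diagMatrix i (⟦ d ⟧ₑ ⊗ (p ⊗ p)) r s))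
  det-realise-twoEdges B d i j p q ts = trans (det-cong bordering) (det-border X ⟦ d ⟧ₑ i j p q)
    where
    X = realise B ts
    B′ = borderE B d (λ _ → cst 0F) (λ _ → cst 0F)
    bordering : ∀ r s → realise B′ (edge zero (suc (suc i)) p ∷ edge (suc zero) (suc (suc j)) q ∷ shift₂ ts) r s ≈ₚ
                        border X ⟦ d ⟧ₑ (λ k → ε i k ⊗ p) (λ k → ε j k ⊗ q) r s
    bordering r s = begin
      ⟦ B′ r s ⟧ₑ ⊕ (E₀ ⊕ (E₁ ⊕ itemSum (shift₂ ts) r s))
        ≈⟨ solve 4 (λ b e₀ e₁ σ → b :+ (e₀ :+ (e₁ :+ σ)) := (b :+ σ) :+ (e₀ :+ e₁)) refl _ E₀ E₁ _ ⟩
      realise B′ (shift₂ ts) r s ⊕ (E₀ ⊕ E₁)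
        ≈⟨ +-congʳ (realise-borderE B d _ _ ts r s) ⟩
      border X ⟦ d ⟧ₑ (λ _ → 0ₚ) (λ _ → 0ₚ) r s ⊕ (E₀ ⊕ E₁)
        ≈⟨ border-absorbEdges X ⟦ d ⟧ₑ _ _ i j p q r s ⟩
      border X ⟦ d ⟧ₑ (λ k → 0ₚ ⊕ ε i k ⊗ p) (λ k → 0ₚ ⊕ ε j k ⊗ q) r s
        ≈⟨ border-cong X ⟦ d ⟧ₑ (λ _ → +-identityˡ _) (λ _ → +-identityˡ _) r s ⟩
      border X ⟦ d ⟧ₑ (λ k → ε i k ⊗ p) (λ k → ε j k ⊗ q) r s ∎
      where
      E₀ = edgeMatrix zero (suc (suc i)) p r s
      E₁ = edgeMatrix (suc zero) (suc (suc j)) q r s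

  det-realise-product : ∀ {n} (B : EntryMatrix n) i j p q ts →
    det (realise (borderE B (cst 0F) (λ _ → cst 0F) (λ _ → cst 0F))
                 (edge zero (suc (suc i)) p ∷ edge (suc zero) (suc (suc j)) q ∷ shift₂ ts)) ≈ₚ
    det (realise B (edge i j (p ⊗ q) ∷ ts))
  det-realise-product B i j p q ts = trans (det-realise-twoEdges B (cst 0F) i j p q ts) (det-cong regroup)
    where
    regroup : ∀ r s → realise B ts r s ⊕ (edgeMatrix i j (p ⊗ q) r s ⊕ diagMatrix i (0ₚ ⊗ (p ⊗ p)) r s) ≈ₚ
                      realise B (edge i j (p ⊗ q) ∷ ts) r s
    regroup r s = solve 6 (λ b σ E a a′ p → (b :+ σ) :+ (E :+ (a :* a′) :* (κ 0 :* (p :* p))) := b :+ (E :+ σ))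
                        refl ⟦ B r s ⟧ₑ (itemSum ts r s) (edgeMatrix i j (p ⊗ q) r s) (ε i r) (ε i s) p

  det-realise-diag : ∀ {n} (B : EntryMatrix n) i e p ts →
    det (realise (borderE B e (λ _ → cst 0F) (λ _ → cst 0F))
                 (edge zero (suc (suc i)) p ∷ edge (suc zero) (suc (suc i)) 0ₚ ∷ shift₂ ts)) ≈ₚ
    det (realise B (diag i e p ∷ ts))
  det-realise-diag B i e p ts = trans (det-realise-twoEdges B e i i p 0ₚ ts) (det-cong regroup)
    where
    regroup : ∀ r s → realise B ts r s ⊕ (edgeMatrix i i (p ⊗ 0ₚ) r s ⊕ diagMatrix i (⟦ e ⟧ₑ ⊗ (p ⊗ p)) r s) ≈ₚ
                      realise B (diag i e p ∷ ts) r s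
    regroup r s = solve 6 (λ b σ D a a′ p → (b :+ σ) :+ ((a :* a′ :+ a :* a′) :* (p :* κ 0) :+ D) := b :+ (D :+ σ))
                        refl ⟦ B r s ⟧ₑ (itemSum ts r s) (diagMatrix i (⟦ e ⟧ₑ ⊗ (p ⊗ p)) r s) (ε i r) (ε i s) p

  realise-negation : ∀ {n} (B : EntryMatrix n) i j p ts r s →
    realise B (edge i j (⊝ p) ∷ ts) r s ≈ₚ realise B (edge i j p ∷ ts) r s
  realise-negation B i j p ts r s = +-congˡ (+-congʳ (*-congˡ (⊝p≈p p)))

  realise-representable : ∀ {n} (B : EntryMatrix n) → SymmetricEntries B → (ts : List (Item n)) →
                          Acc _<_ (totalWeight ts) → Representable (det (realise B ts))
  realise-representable B B-sym [] _ =
    _ , B , (λ r s → reflexive (≡.cong ⟦_⟧ₑ (B-sym r s))) , det-cong {M = ⟦ B ⟧ₘ} (λ r s → sym (+-identityʳ _))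
  realise-representable B B-sym (edge i j (con a) ∷ ts) (acc smaller) =
    representable-cong (det-realise-atomic B i j (cst a) ts)
      (realise-representable _ (bordered-sym _ _ _ _ _ B-sym) (shift₂ ts) (smaller (s≤s (≤-reflexive (totalWeight-shift₂ ts)))))
  realise-representable B B-sym (edge i j (var k) ∷ ts) (acc smaller) =
    representable-cong (det-realise-atomic B i j (x k) ts)
      (realise-representable _ (bordered-sym _ _ _ _ _ B-sym) (shift₂ ts) (smaller (s≤s (≤-reflexive (totalWeight-shift₂ ts)))))
  realise-representable B B-sym (edge i j (p ⊕ q) ∷ ts) (acc smaller) =
    representable-cong (det-cong (λ r s → sym (realise-sum B i j p q ts r s)))
      (realise-representable B B-sym (edge i j p ∷ edge i j q ∷ ts) (smaller (+-regroup< (size p) (size q) ≡.refl)))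
  realise-representable B B-sym (edge i j (p ⊗ q) ∷ ts) (acc smaller) =
    representable-cong (det-realise-product B i j p q ts)
      (realise-representable _ (bordered-sym _ _ _ _ _ B-sym) (edge zero (suc (suc i)) p ∷ edge (suc zero) (suc (suc j)) q ∷ shift₂ ts)
        (smaller (+-regroup< (size p) (size q) (totalWeight-shift₂ ts))))
  realise-representable B B-sym (edge i j (⊝ p) ∷ ts) (acc smaller) =
    representable-cong (det-cong (λ r s → sym (realise-negation B i j p ts r s)))
      (realise-representable B B-sym (edge i j p ∷ ts) (smaller (ℕₚ.n<1+n _)))
  realise-representable B B-sym (diag i e p ∷ ts) (acc smaller) =
    representable-cong (det-realise-diag B i e p ts)
      (realise-representable _ (bordered-sym _ _ _ _ _ B-sym) (edge zero (suc (suc i)) p ∷ edge (suc zero) (suc (suc i)) 0ₚ ∷ shift₂ ts)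
        (smaller (+-regroup< (size p) (size 0ₚ) (totalWeight-shift₂ ts))))

  -- From a gSDR to a representation

  squaresPart≈ : ∀ {q} (f : DiagonalForm q) → squaresPart f ≈ₚ q ⊕ ⟦ constantPart f ⟧ₑ
  squaresPart≈ (inj₁ (a , q≈a)) = sym (trans (+-congʳ q≈a) (x⊕x≈0 (con a)))
  squaresPart≈ {q} (inj₂ (p₀ , ps , q≈)) = sym (trans (+-identityʳ q) (trans q≈ (+-congˡ (reflexive (Σ[]≡sum squares)))))
    where
    squares = λ k → var k ⊗ (ps k ⊗ ps k)

  itemSum-initialItems : ∀ {n} (M : Matrix n) → Symmetric M → (forms : ∀ i → DiagonalForm (M i i)) →
    ∀ r s → itemSum (initialItems M forms) r s ≈ₚ M r s ⊕ ε r s ⊗ ⟦ constantPart (forms r) ⟧ₑ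
  itemSum-initialItems {suc n} M M-sym forms r s = begin
    itemSum (squareItems (forms zero) ++ edges ++ map ↑ rest) r s
      ≈⟨ trans (itemSum-++ (squareItems (forms zero)) (edges ++ map ↑ rest) r s) (+-congˡ (itemSum-++ edges (map ↑ rest) r s)) ⟩
    itemSum (squareItems (forms zero)) r s ⊕ (itemSum edges r s ⊕ itemSum (map ↑ rest) r s)
      ≈⟨ +-cong (itemSum-squareItems (forms zero) r s) (+-congʳ (reflexive (itemSum-tabulate firstRow r s))) ⟩
    diagMatrix zero (squaresPart (forms zero)) r s ⊕ (∑[ j < n ] edgeMatrix zero (suc j) (M zero (suc j)) r s ⊕ itemSum (map ↑ rest) r s)
      ≈⟨ firstRow-decomposition M M-sym (λ t → ⟦ constantPart (forms t) ⟧ₑ) _ rest (squaresPart≈ (forms zero))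
                                (itemSum-initialItems (minor zero M) (λ i j → M-sym (suc i) (suc j)) (forms ∘ suc)) r s ⟩
    M r s ⊕ ε r s ⊗ ⟦ constantPart (forms r) ⟧ₑ ∎
    where
    firstRow = λ j → edge zero (suc j) (M zero (suc j))
    edges = tabulate firstRow
    rest = initialItems (minor zero M) (forms ∘ suc)

  realise-initial : ∀ {n} (M : Matrix n) → Symmetric M → (forms : ∀ i → DiagonalForm (M i i)) →
                    ∀ r s → realise (initialEntries M forms) (initialItems M forms) r s ≈ₚ M r s
  realise-initial M M-sym forms r s = begin
    ⟦ εₑ r s e ⟧ₑ ⊕ itemSum (initialItems M forms) r s      ≈⟨ +-cong (⟦εₑ⟧ r s e) (itemSum-initialItems M M-sym forms r s) ⟩
    ε r s ⊗ ⟦ e ⟧ₑ ⊕ (M r s ⊕ ε r s ⊗ ⟦ e ⟧ₑ)              ≈⟨ solve 2 (λ y z → y :+ (z :+ y) := z :+ (y :+ y)) refl _ (M r s) ⟩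
    M r s ⊕ (ε r s ⊗ ⟦ e ⟧ₑ ⊕ ε r s ⊗ ⟦ e ⟧ₑ)              ≈⟨ +-congˡ (x⊕x≈0 _) ⟩
    M r s ⊕ 0ₚ                                           ≈⟨ +-identityʳ _ ⟩
    M r s                                                ∎
    where
    e = constantPart (forms r)

  hasGSDR⇒representable : ∀ {P} → HasGSDR P → Representable P
  hasGSDR⇒representable (n , M , M-sym , detM≈P , forms) =
    representable-cong (trans (det-cong (realise-initial M M-sym forms)) detM≈P)
      (realise-representable (initialEntries M forms) (εₑ-diagonal-sym (constantPart ∘ forms)) (initialItems M forms)
                             (<-wellFounded _))

theorem3p5 : ∀ {c ℓ} (F : Field c ℓ) → Char2 F → (m : ℕ) (P : PolyRing.Poly F m) →
  PolyRing.Representable F m P ⇔ PolyRing.HasGSDR F m P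
theorem3p5 F char2 m P =
  mk⇔ (Polynomials.representable⇒hasGSDR F m) (InCharacteristic2.hasGSDR⇒representable F char2 m)
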